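{- Let $G$ be a graph and let $\mathcal{F}$ be a family of graphs, each having exactly $m$ edges, which is closed in $G$. Let $f: E(G)\to\{ -1,1\}$. Suppose there are subgraphs $H, H'$ of $G$, each isomorphic to a member of $\mathcal{F}$, with $f(H)\le 0$ and $f(H')\ge 0$. Then there is a subgraph $Z$ of $G$, isomorphic to a member of $\mathcal{F}$, which is zero-sum or almost zero-sum under $f$, i.e. $|f(Z)|\le 1$.
   Context: For $f:E(G)\to\{ -1,1\}$ and a subgraph $H\le G$, $f(H)=\sum_{e\in E(H)} f(e)$ (sum in $\mathbb{Z}$). $H$ is zero-sum if $f(H)=0$ and almost zero-sum if $|f(H)|=1$. Given a subgraph $H$ of $G$, a subgraph $H'$ of $G$ is obtained from $H$ by an edge-replacement if there are edges $e\in E(H)$ and $e'\in E(H')\setminus E(H)$ with $E(H')=(E(H)\setminus\{e\})\cup\{e'\}$. A family $\mathcal{F}$ of graphs is closed in $G$ if for any two subgraphs $H,H'$ of $G$ each isomorphic to a member of $\mathcal{F}$, there is a chain $H=H_1,H_2,\dots,H_q=H'$ of subgraphs of $G$, each isomorphic to a member of $\mathcal{F}$, such that for $1\le i\le q-1$, $H_{i+1}$ is obtained from $H_i$ by an edge-replacement. -}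

module Defs where

open import Data.Nat using (ℕ)
open import Data.Integer using (ℤ; 0ℤ; _+_; +_; -[1+_])
open import Data.Fin using (Fin)
open import Data.Fin.Subset using (Subset; Side; inside; outside; _∈_; _∉_)
open import Data.Vec using (lookup)
open import Data.List using (List; foldr; map; allFin)
open import Data.Product using (Σ; ∃; _×_; _,_; proj₁; proj₂)
open import Data.Sum using (_⊎_)
open import Relation.Binary.PropositionalEquality using (_≡_; _≢_)
open import Relation.Binary.Construct.Closure.ReflexiveTransitive using (Star)
open import Function using (_⇔_)
open import Function.Definitions using (Injective)

SameEnds : ∀ {n} → Fin n × Fin n → Fin n × Fin n → Set
SameEnds (a , b) (c , d) = (a ≡ c × b ≡ d) ⊎ (a ≡ d × b ≡ c)

record Graph : Set where
  field
    nV       : ℕ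
    nE       : ℕ
    ends     : Fin nE → Fin nV × Fin nV
    loopless : ∀ e → proj₁ (ends e) ≢ proj₂ (ends e)
    simple   : ∀ e e' → SameEnds (ends e) (ends e') → e ≡ e'
open Graph public

Adj : (G : Graph) → Fin (nV G) → Fin (nV G) → Set
Adj G u v = ∃ λ e → SameEnds (ends G e) (u , v)

record Subgraph (G : Graph) : Set where
  field
    VS     : Subset (nV G)
    ES     : Subset (nE G)
    closed : ∀ e → e ∈ ES → proj₁ (ends G e) ∈ VS × proj₂ (ends G e) ∈ VS
open Subgraph public

AdjS : {G : Graph} → Subgraph G → Fin (nV G) → Fin (nV G) → Set
AdjS {G} H u v = ∃ λ e → e ∈ ES H × SameEnds (ends G e) (u , v)

_≅_ : {G : Graph} → Subgraph G → Graph → Set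
_≅_ {G} H F =
  Σ (Fin (nV F) → Fin (nV G)) λ φ →
    Injective _≡_ _≡_ φ
    × (∀ a → φ a ∈ VS H)
    × (∀ v → v ∈ VS H → ∃ λ a → φ a ≡ v)
    × (∀ a b → Adj F a b ⇔ AdjS H (φ a) (φ b))

Family : Set₁
Family = Graph → Set

InFam : {G : Graph} → Family → Subgraph G → Set
InFam 𝓕 H = ∃ λ F → 𝓕 F × H ≅ F

EdgeReplacement : {G : Graph} → Subgraph G → Subgraph G → Set
EdgeReplacement {G} H H' =
  Σ (Fin (nE G)) λ e → Σ (Fin (nE G)) λ e' →
    e ∈ ES H × e' ∈ ES H' × e' ∉ ES H
    × (∀ x → x ∈ ES H' ⇔ ((x ∈ ES H × x ≢ e) ⊎ x ≡ e'))

FamStep : {G : Graph} → Family → Subgraph G → Subgraph G → Set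
FamStep 𝓕 H H' = InFam 𝓕 H × EdgeReplacement H H' × InFam 𝓕 H'

ClosedIn : Family → Graph → Set
ClosedIn 𝓕 G = ∀ (H H' : Subgraph G) → InFam 𝓕 H → InFam 𝓕 H' → Star (FamStep 𝓕) H H'

IsSigning : (G : Graph) → (Fin (nE G) → ℤ) → Set
IsSigning G f = ∀ e → f e ≡ + 1 ⊎ f e ≡ -[1+ 0 ]

sideWeight : Side → ℤ → ℤ
sideWeight inside  z = z
sideWeight outside z = 0ℤ

fSum : {G : Graph} → (Fin (nE G) → ℤ) → Subgraph G → ℤ
fSum {G} f H = foldr _+_ 0ℤ (map (λ e → sideWeight (lookup (ES H) e) (f e)) (allFin (nE G)))

-- An edge-replacement trading e for e' changes f by f(e') - f(e) ∈ {-2, 0, 2}.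
-- Closedness gives a chain of such replacements from H to H' inside the family,
-- along which f climbs from a nonpositive to a nonnegative value in steps of at
-- most 2; such a walk cannot jump over the window {-1, 0, 1}.
module Submission where

open import Defs
open import Data.Nat using (ℕ) renaming (_≤_ to _≤ℕ_)
open import Data.Integer using (ℤ; 0ℤ; _≤_; ∣_∣)
open import Data.Fin using (Fin)
open import Data.Product using (∃; _×_)
open import Relation.Binary.PropositionalEquality using (_≡_)

open import Data.Nat using (zero; suc; z≤n; s≤s)
open import Data.Integer using (+_; -[1+_]; _+_; _-_; -_; +≤+; -≤+; -≤-)
open import Data.Integer.Properties
  using (+-identityˡ; +-identityʳ; +-assoc; +-inverseʳ; +-monoʳ-≤; +-monoˡ-≤; ≤-trans; ≤-refl; ≤-antisym;
         +-commutativeSemigroup; +-0-commutativeMonoid)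
open import Algebra.Properties.CommutativeSemigroup +-commutativeSemigroup using (interchange)
open import Algebra.Properties.CommutativeMonoid.Sum +-0-commutativeMonoid using (sum)
open import Data.Bool using (_∧_; _∨_)
open import Data.Fin using (zero; suc; _≟_)
open import Data.Fin.Subset using (Subset; inside; outside; _∈_; _∉_; _∪_; _∩_; ⊥; ⁅_⁆; Empty)
open import Data.Fin.Subset.Properties
  using (x∈p∩q⁻; x∈p∪q⁺; x∈p∪q⁻; x∈⁅x⁆; x∈⁅y⁆⇒x≡y; ⊆-antisym; drop-∷-Empty; Empty-unique)
import Data.Vec as Vec
open import Data.Vec using (_∷_; []; lookup)
open import Data.Vec.Functional using (Vector; toList)
open import Data.List using (foldr; map; allFin)
open import Data.List.Properties using (map-tabulate)
open import Data.Product using (_,_)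
open import Data.Sum using (_⊎_; inj₁; inj₂)
open import Function using (_∘_; id; _⇔_; Equivalence)
open import Relation.Nullary using (yes; no)
open import Relation.Binary.PropositionalEquality using (_≢_; refl; sym; trans; cong; cong₂; subst; subst₂; module ≡-Reasoning)
open import Relation.Binary.Construct.Closure.ReflexiveTransitive using (Star; ε; _◅_)

open ≡-Reasoning
open Equivalence using (to; from)

PlusMinusOne : ℤ → Set
PlusMinusOne c = c ≡ + 1 ⊎ c ≡ -[1+ 0 ]

±1-difference-≤2 : ∀ {s t} → PlusMinusOne s → PlusMinusOne t → t - s ≤ + 2
±1-difference-≤2 (inj₁ refl) (inj₁ refl) = +≤+ z≤n
±1-difference-≤2 (inj₂ refl) (inj₁ refl) = ≤-refl
±1-difference-≤2 (inj₁ refl) (inj₂ refl) = -≤+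
±1-difference-≤2 (inj₂ refl) (inj₂ refl) = +≤+ z≤n

±1-exchange-≤ : ∀ {i j s t} → PlusMinusOne s → PlusMinusOne t → j + s ≡ i + t → j ≤ i + + 2
±1-exchange-≤ {i} {j} {s} {t} ±1s ±1t j+s≡i+t =
  subst (_≤ i + + 2) (sym j≡i+[t-s]) (+-monoʳ-≤ i (±1-difference-≤2 ±1s ±1t))
  where
  j≡i+[t-s] : j ≡ i + (t - s)
  j≡i+[t-s] = begin
    j             ≡⟨ sym (+-identityʳ j) ⟩
    j + 0ℤ        ≡⟨ cong (λ v → j + v) (sym (+-inverseʳ s)) ⟩
    j + (s - s)   ≡⟨ sym (+-assoc j s (- s)) ⟩
    (j + s) - s   ≡⟨ cong (_- s) j+s≡i+t ⟩
    (i + t) - s   ≡⟨ +-assoc i t (- s) ⟩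
    i + (t - s)   ∎

-- A nonpositive value either is within 1 of zero or is at most -2, and from
-- there one step of size at most 2 cannot overshoot zero.
discrete-intermediate-value :
  ∀ {a r p} {A : Set a} {R : A → A → Set r} (P : A → Set p) (φ : A → ℤ)
  → (∀ {x y} → R x y → P y)
  → (∀ {x y} → R x y → φ y ≤ φ x + + 2)
  → ∀ {x y} → Star R x y → P x → φ x ≤ 0ℤ → 0ℤ ≤ φ y
  → ∃ λ z → P z × ∣ φ z ∣ ≤ℕ 1
discrete-intermediate-value {R = R} P φ R⇒P step≤2 = go
  where
  go : ∀ {x y} → Star R x y → P x → φ x ≤ 0ℤ → 0ℤ ≤ φ y → ∃ λ z → P z × ∣ φ z ∣ ≤ℕ 1
  go {x} ε Px φx≤0 0≤φx = x , Px , subst (λ v → ∣ v ∣ ≤ℕ 1) (sym (≤-antisym φx≤0 0≤φx)) z≤n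
  go {x} (xRw ◅ rest) Px φx≤0 0≤φy with φ x in φx≡
  ... | + zero        = x , Px , subst (λ v → ∣ v ∣ ≤ℕ 1) (sym φx≡) z≤n
  ... | -[1+ zero ]   = x , Px , subst (λ v → ∣ v ∣ ≤ℕ 1) (sym φx≡) (s≤s z≤n)
  go (_ ◅ _) _ (+≤+ ()) _ | + suc _
  ... | -[1+ suc k ]  = go rest (R⇒P xRw) φw≤0 0≤φy
    where
    φw≤0 : φ _ ≤ 0ℤ
    φw≤0 = ≤-trans (subst (λ v → φ _ ≤ v + + 2) φx≡ (step≤2 xRw))
                   (+-monoˡ-≤ (+ 2) { -[1+ suc k ]} { -[1+ 1 ]} (-≤- (s≤s z≤n)))

weight : ∀ {n} → (Fin n → ℤ) → Subset n → ℤ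
weight f p = sum (λ x → sideWeight (lookup p x) (f x))

fSum≡weight : ∀ {G} (f : Fin (nE G) → ℤ) (H : Subgraph G) → fSum f H ≡ weight f (ES H)
fSum≡weight f H = begin
  foldr _+_ 0ℤ (map g (allFin _))  ≡⟨ cong (foldr _+_ 0ℤ) (map-tabulate id g) ⟩
  foldr _+_ 0ℤ (toList g)          ≡⟨ foldr-toList g ⟩
  sum g                            ∎
  where
  g = λ x → sideWeight (lookup (ES H) x) (f x)

  foldr-toList : ∀ {n} (v : Vector ℤ n) → foldr _+_ 0ℤ (toList v) ≡ sum v
  foldr-toList {zero}  v = refl
  foldr-toList {suc n} v = cong (λ w → v zero + w) (foldr-toList (v ∘ suc))

weight-⊥ : ∀ {n} (f : Fin n → ℤ) → weight f ⊥ ≡ 0ℤ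
weight-⊥ {zero}  f = refl
weight-⊥ {suc n} f = trans (+-identityˡ _) (weight-⊥ (f ∘ suc))

weight-⁅⁆ : ∀ {n} (f : Fin n → ℤ) (e : Fin n) → weight f ⁅ e ⁆ ≡ f e
weight-⁅⁆ f zero    = trans (cong (λ v → f zero + v) (weight-⊥ (f ∘ suc))) (+-identityʳ (f zero))
weight-⁅⁆ f (suc e) = trans (+-identityˡ _) (weight-⁅⁆ (f ∘ suc) e)

sideWeight-∨ : ∀ a b c → a ∧ b ≡ outside → sideWeight (a ∨ b) c ≡ sideWeight a c + sideWeight b c
sideWeight-∨ inside  inside  c ()
sideWeight-∨ inside  outside c _ = sym (+-identityʳ c)
sideWeight-∨ outside b       c _ = sym (+-identityˡ (sideWeight b c))

weight-∪ : ∀ {n} (f : Fin n → ℤ) (p q : Subset n) → Empty (p ∩ q) → weight f (p ∪ q) ≡ weight f p + weight f q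
weight-∪ f []      []      _        = refl
weight-∪ f (a ∷ p) (b ∷ q) disjoint = begin
  sideWeight (a ∨ b) (f zero) + weight (f ∘ suc) (p ∪ q)
    ≡⟨ cong₂ _+_ (sideWeight-∨ a b (f zero) (cong Vec.head (Empty-unique disjoint)))
                 (weight-∪ (f ∘ suc) p q (drop-∷-Empty disjoint)) ⟩
  (sideWeight a (f zero) + sideWeight b (f zero)) + (weight (f ∘ suc) p + weight (f ∘ suc) q)
    ≡⟨ interchange (sideWeight a (f zero)) (sideWeight b (f zero)) (weight (f ∘ suc) p) (weight (f ∘ suc) q) ⟩
  weight f (a ∷ p) + weight f (b ∷ q)
    ∎

∉⇒Empty-∩⁅⁆ : ∀ {n} {p : Subset n} {e} → e ∉ p → Empty (p ∩ ⁅ e ⁆)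
∉⇒Empty-∩⁅⁆ {p = p} {e} e∉p (x , x∈p∩⁅e⁆) with x∈p∩q⁻ p ⁅ e ⁆ x∈p∩⁅e⁆
... | x∈p , x∈⁅e⁆ = e∉p (subst (_∈ p) (x∈⁅y⁆⇒x≡y e x∈⁅e⁆) x∈p)

module _ {n} {p q : Subset n} {e e' : Fin n} (e∈p : e ∈ p) (e'∉p : e' ∉ p)
         (q≡p-e+e' : ∀ x → x ∈ q ⇔ ((x ∈ p × x ≢ e) ⊎ x ≡ e')) where

  replacement-∉ : e ∉ q
  replacement-∉ e∈q with to (q≡p-e+e' e) e∈q
  ... | inj₁ (_ , e≢e) = e≢e refl
  ... | inj₂ refl      = e'∉p e∈p

  replacement-∪⁅⁆ : q ∪ ⁅ e ⁆ ≡ p ∪ ⁅ e' ⁆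
  replacement-∪⁅⁆ = ⊆-antisym ⊆ ⊇
    where
    ⊆ : ∀ {x} → x ∈ q ∪ ⁅ e ⁆ → x ∈ p ∪ ⁅ e' ⁆
    ⊆ x∈ with x∈p∪q⁻ q ⁅ e ⁆ x∈
    ... | inj₂ x∈⁅e⁆ = x∈p∪q⁺ (inj₁ (subst (_∈ p) (sym (x∈⁅y⁆⇒x≡y e x∈⁅e⁆)) e∈p))
    ... | inj₁ x∈q with to (q≡p-e+e' _) x∈q
    ...   | inj₁ (x∈p , _) = x∈p∪q⁺ (inj₁ x∈p)
    ...   | inj₂ refl      = x∈p∪q⁺ (inj₂ (x∈⁅x⁆ e'))

    ⊇ : ∀ {x} → x ∈ p ∪ ⁅ e' ⁆ → x ∈ q ∪ ⁅ e ⁆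
    ⊇ {x} x∈ with x∈p∪q⁻ p ⁅ e' ⁆ x∈ | x ≟ e
    ... | _          | yes refl = x∈p∪q⁺ (inj₂ (x∈⁅x⁆ e))
    ... | inj₁ x∈p   | no x≢e   = x∈p∪q⁺ (inj₁ (from (q≡p-e+e' x) (inj₁ (x∈p , x≢e))))
    ... | inj₂ x∈⁅e'⁆ | no _    = x∈p∪q⁺ (inj₁ (from (q≡p-e+e' x) (inj₂ (x∈⁅y⁆⇒x≡y e' x∈⁅e'⁆))))

  weight-replacement : (f : Fin n → ℤ) → weight f q + f e ≡ weight f p + f e'
  weight-replacement f = begin
    weight f q + f e              ≡⟨ cong (λ v → weight f q + v) (sym (weight-⁅⁆ f e)) ⟩
    weight f q + weight f ⁅ e ⁆   ≡⟨ sym (weight-∪ f q ⁅ e ⁆ (∉⇒Empty-∩⁅⁆ replacement-∉)) ⟩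
    weight f (q ∪ ⁅ e ⁆)          ≡⟨ cong (weight f) replacement-∪⁅⁆ ⟩
    weight f (p ∪ ⁅ e' ⁆)         ≡⟨ weight-∪ f p ⁅ e' ⁆ (∉⇒Empty-∩⁅⁆ e'∉p) ⟩
    weight f p + weight f ⁅ e' ⁆  ≡⟨ cong (λ v → weight f p + v) (weight-⁅⁆ f e') ⟩
    weight f p + f e'             ∎

fSum-edgeReplacement-≤ : ∀ {G} (f : Fin (nE G) → ℤ) → IsSigning G f
  → ∀ {H H' : Subgraph G} → EdgeReplacement H H' → fSum f H' ≤ fSum f H + + 2
fSum-edgeReplacement-≤ f signing {H} {H'} (e , e' , e∈H , _ , e'∉H , H'≡H-e+e')
  = subst₂ (λ a b → a ≤ b + + 2) (sym (fSum≡weight f H')) (sym (fSum≡weight f H))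
      (±1-exchange-≤ {weight f (ES H)} {weight f (ES H')} (signing e) (signing e') (weight-replacement e∈H e'∉H H'≡H-e+e' f))

lemma3p2 : (G : Graph) (𝓕 : Family) (m : ℕ)
    → (∀ F → 𝓕 F → nE F ≡ m)
    → ClosedIn 𝓕 G
    → (f : Fin (nE G) → ℤ) → IsSigning G f
    → (H H' : Subgraph G) → InFam 𝓕 H → InFam 𝓕 H'
    → fSum f H ≤ 0ℤ → 0ℤ ≤ fSum f H'
    → ∃ λ (Z : Subgraph G) → InFam 𝓕 Z × ∣ fSum f Z ∣ ≤ℕ 1
lemma3p2 G 𝓕 _ _ closed f signing H H' H∈𝓕 H'∈𝓕 =
  discrete-intermediate-value (InFam 𝓕) (fSum f)
    (λ (_ , _ , Z'∈𝓕) → Z'∈𝓕)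
    (λ {Z} {Z'} (_ , replacement , _) → fSum-edgeReplacement-≤ f signing {Z} {Z'} replacement)
    (closed H H' H∈𝓕 H'∈𝓕) H∈𝓕
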